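{- $g_{2,2}(2)=g_{2,3}(2)=3$.
   Context: For positive integers $a,b$, let $Q_{a,b}=\{\alpha_0+\alpha_1\mathbf{i}+\alpha_2\mathbf{j}+\alpha_3\mathbf{k} : \alpha_0,\alpha_1,\alpha_2,\alpha_3\in\mathbb{Z}\}$ be the quaternion ring with $\mathbf{i}^2=-a$, $\mathbf{j}^2=-b$, $\mathbf{i}\mathbf{j}=-\mathbf{j}\mathbf{i}=\mathbf{k}$ (so $\mathbf{k}^2=-ab$). Let $Q_{a,b}^2$ denote the additive group generated by all squares $x^2$, $x\in Q_{a,b}$. $g_{a,b}(2)$ denotes the least positive integer $g$ such that every element of $Q_{a,b}^2$ can be written as a sum of at most $g$ squares of elements of $Q_{a,b}$. -}

module Defs where

open import Data.Nat using (ℕ; _≤_; _<_) renaming (_*_ to _*ℕ_)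
open import Data.Integer using (ℤ; +_; -_; _+_; _*_; _-_)
open import Data.List using (List; []; _∷_; length; foldr; map)
open import Data.Product using (_×_; ∃; ∃-syntax; _,_)
open import Relation.Binary.PropositionalEquality using (_≡_)
open import Relation.Nullary using (¬_)

-- Elements α₀ + α₁ i + α₂ j + α₃ k of Q_{a,b}, α's integers.
record Quat : Set where
  constructor quat
  field
    c0 c1 c2 c3 : ℤ
open Quat public

-- Ring operations of Q_{a,b}: i² = -a, j² = -b, ij = -ji = k, k² = -ab.
-- (Hence ik = -a j, ki = a j, jk = b i, kj = -b i.)
module QuatOps (a b : ℕ) where
  A B : ℤ
  A = + a
  B = + b

  0Q : Quat
  0Q = quat (+ 0) (+ 0) (+ 0) (+ 0)

  _+Q_ : Quat → Quat → Quat
  quat x0 x1 x2 x3 +Q quat y0 y1 y2 y3 = quat (x0 + y0) (x1 + y1) (x2 + y2) (x3 + y3)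

  -Q_ : Quat → Quat
  -Q quat x0 x1 x2 x3 = quat (- x0) (- x1) (- x2) (- x3)

  _*Q_ : Quat → Quat → Quat
  quat x0 x1 x2 x3 *Q quat y0 y1 y2 y3 = quat
    (x0 * y0 - A * (x1 * y1) - B * (x2 * y2) - (A * B) * (x3 * y3))
    (x0 * y1 + x1 * y0 + B * (x2 * y3 - x3 * y2))
    (x0 * y2 + x2 * y0 + A * (x3 * y1 - x1 * y3))
    (x0 * y3 + x3 * y0 + x1 * y2 - x2 * y1)

  sq : Quat → Quat
  sq x = x *Q x

  data InSqGroup : Quat → Set where
    gen  : ∀ x → InSqGroup (sq x)
    zero : InSqGroup 0Q
    neg  : ∀ {q} → InSqGroup q → InSqGroup (-Q q)
    add  : ∀ {p q} → InSqGroup p → InSqGroup q → InSqGroup (p +Q q)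

  sumSq : List Quat → Quat
  sumSq xs = foldr (λ x acc → sq x +Q acc) 0Q xs

  SumOfAtMost : ℕ → Set
  SumOfAtMost g = ∀ q → InSqGroup q → ∃[ xs ] (length xs ≤ g × sumSq xs ≡ q)

IsG2 : ℕ → ℕ → ℕ → Set
IsG2 a b g = 0 < g × SumOfAtMost g × (∀ h → 0 < h → SumOfAtMost h → g ≤ h)
  where open QuatOps a b

module Submission where

-- Write x = x₀ + v with v pure and N(v) = a v₁² + b v₂² + ab v₃², so that x² = x₀² − N(v) + 2x₀v.
-- Every square, hence every element of Q², has even pure part.  For a = 2 the converse holds with
-- three squares: (r + 1 + v)² + (r − v − c𝐢)² + (c + r𝐢)² = 2r + 1 − c² − 2N(v) − 4cv₁ + 2v, because
-- the r² terms cancel against N(r𝐢) = 2r²; choosing c ∈ {0, 1} for the parity of the real part and r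
-- linearly hits every target.  On the other side 2𝐤 = (1 + 𝐤)² + (ab − 1) lies in Q², and
-- (p + x)² + (q + y)² = 2𝐤 means p² + q² = N(x) + N(y), px₁ + qy₁ = px₂ + qy₂ = 0, px₃ + qy₃ = 1.
-- For (a, b) = (2, 2) these are incompatible modulo 4 once the parities of p and q are fixed.  For
-- (2, 3) they give 3 ∣ (p ± x₁)² + (q ± y₁)², and since −1 is not a square modulo 3 this forces
-- 3 ∣ p and 3 ∣ q, contradicting px₃ + qy₃ = 1.

open import Defs
open import Data.Nat as ℕ using (ℕ; zero; suc; s≤s; z≤n)
import Data.Nat.Properties as ℕ
open import Data.Integer using (ℤ; +_; -[1+_]; -_; _+_; _*_; _-_)
open import Data.Integer.Properties using (+-identityˡ; +-comm; *-cancelˡ-≡)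
open import Data.Integer.DivMod using (_%_; _/_; n%d<d; a≡a%n+[a/n]*n)
open import Data.Integer.Divisibility.Signed
  using (_∣_; divides; _∣?_; ∣-refl; ∣m∣n⇒∣m+n; ∣m∣n⇒∣m-n; ∣m⇒∣-m; ∣m+n∣n⇒∣m; ∣m⇒∣m*n; ∣n⇒∣m*n)
open import Data.Integer.Tactic.RingSolver using (solve-∀)
open import Data.List using (List; []; _∷_; foldr; length)
open import Data.Product using (_×_; _,_; ∃-syntax)
open import Data.Empty using (⊥; ⊥-elim)
open import Data.Unit using (tt)
open import Relation.Binary.PropositionalEquality
open import Relation.Nullary using (¬_; yes; no)
open import Relation.Nullary.Decidable using (False; toWitnessFalse)

quat-cong : ∀ {x0 x1 x2 x3 y0 y1 y2 y3} → x0 ≡ y0 → x1 ≡ y1 → x2 ≡ y2 → x3 ≡ y3 →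
            quat x0 x1 x2 x3 ≡ quat y0 y1 y2 y3
quat-cong refl refl refl refl = refl

residue : ∀ d .{{_ : ℕ.NonZero d}} x → ∃[ r ] ∃[ k ] (r ℕ.< d × x ≡ + r + k * + d)
residue d x = x % + d , x / + d , n%d<d x (+ d) , a≡a%n+[a/n]*n x (+ d)

∤-by-decision : ∀ {d n} → False (d ∣? n) → ¬ d ∣ n
∤-by-decision = toWitnessFalse

∣-multiple : ∀ {d} k → d ∣ k * d
∣-multiple k = divides k refl

∣0+k*d : ∀ {d} k → d ∣ + 0 + k * d
∣0+k*d k = divides k (+-identityˡ _)

∣p∣q⇒∣px+qy : ∀ {d p q} x y → d ∣ p → d ∣ q → d ∣ p * x + q * y
∣p∣q⇒∣px+qy x y d∣p d∣q = ∣m∣n⇒∣m+n (∣m⇒∣m*n x d∣p) (∣m⇒∣m*n y d∣q)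

3∣r²+s²⇒r≡0 : ∀ r s → r ℕ.< 3 → s ℕ.< 3 → + 3 ∣ + r * + r + + s * + s → r ≡ 0
3∣r²+s²⇒r≡0 0 _ _ _ _ = refl
3∣r²+s²⇒r≡0 1 0 _ _ h = ⊥-elim (∤-by-decision tt h)
3∣r²+s²⇒r≡0 1 1 _ _ h = ⊥-elim (∤-by-decision tt h)
3∣r²+s²⇒r≡0 1 2 _ _ h = ⊥-elim (∤-by-decision tt h)
3∣r²+s²⇒r≡0 2 0 _ _ h = ⊥-elim (∤-by-decision tt h)
3∣r²+s²⇒r≡0 2 1 _ _ h = ⊥-elim (∤-by-decision tt h)
3∣r²+s²⇒r≡0 2 2 _ _ h = ⊥-elim (∤-by-decision tt h)
3∣r²+s²⇒r≡0 (suc (suc (suc _))) _ (s≤s (s≤s (s≤s ()))) _ _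
3∣r²+s²⇒r≡0 (suc _) (suc (suc (suc _))) _ (s≤s (s≤s (s≤s ()))) _

3∣m²+n²⇒3∣m : ∀ m n → + 3 ∣ m * m + n * n → + 3 ∣ m
3∣m²+n²⇒3∣m m n 3∣m²+n² with residue 3 m | residue 3 n
... | r , M , r<3 , refl | s , N , s<3 , refl = subst (λ r → + 3 ∣ + r + M * + 3) (sym r≡0) (∣0+k*d M)
  where
  expand : ∀ r M s N → (r + M * + 3) * (r + M * + 3) + (s + N * + 3) * (s + N * + 3)
                         ≡ (r * r + s * s) + (+ 2 * (r * M) + + 2 * (s * N) + (M * M + N * N) * + 3) * + 3
  expand = solve-∀
  r≡0 : r ≡ 0
  r≡0 = 3∣r²+s²⇒r≡0 r s r<3 s<3
    (∣m+n∣n⇒∣m (subst (+ 3 ∣_) (expand (+ r) M (+ s) N) 3∣m²+n²)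
               (∣-multiple (+ 2 * (+ r * M) + + 2 * (+ s * N) + (M * M + N * N) * + 3)))

3∣m²+n²⇒3∣n : ∀ m n → + 3 ∣ m * m + n * n → + 3 ∣ n
3∣m²+n²⇒3∣n m n h = 3∣m²+n²⇒3∣m n m (subst (+ 3 ∣_) (+-comm (m * m) (n * n)) h)

3∣m+n⇒3∣m-n⇒3∣m : ∀ m n → + 3 ∣ m + n → + 3 ∣ m - n → + 3 ∣ m
3∣m+n⇒3∣m-n⇒3∣m m n 3∣m+n 3∣m-n = subst (+ 3 ∣_) (sym (recombine m n))
  (∣m∣n⇒∣m-n (∣m∣n⇒∣m+n (∣m⇒∣m*n (+ 2) 3∣m+n) (∣m⇒∣m*n (+ 2) 3∣m-n)) (∣n⇒∣m*n m ∣-refl))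
  where
  recombine : ∀ m n → m ≡ (m + n) * + 2 + (m - n) * + 2 - m * + 3
  recombine = solve-∀

∣4⇒∣[r+2P]²+[s+2Q]²⇒∣r²+s² : ∀ {d} r P s Q → d ∣ + 4 →
  d ∣ (r + P * + 2) * (r + P * + 2) + (s + Q * + 2) * (s + Q * + 2) → d ∣ r * r + s * s
∣4⇒∣[r+2P]²+[s+2Q]²⇒∣r²+s² r P s Q d∣4 h =
  ∣m+n∣n⇒∣m (subst (_ ∣_) (expand r P s Q) h) (∣n⇒∣m*n (r * P + s * Q + P * P + Q * Q) d∣4)
  where
  expand : ∀ r P s Q → (r + P * + 2) * (r + P * + 2) + (s + Q * + 2) * (s + Q * + 2)
                         ≡ (r * r + s * s) + (r * P + s * Q + P * P + Q * Q) * + 4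
  expand = solve-∀

-- With E = (1 + 2P)x + (1 + 2Q)y = 0 we get x + y = −2(Px + Qy), and 2(x² + y²) = 2(x + y)² − 4xy.
[1+2P]x+[1+2Q]y≡0⇒4∣2[x²+y²] : ∀ P Q x y → (+ 1 + P * + 2) * x + (+ 1 + Q * + 2) * y ≡ + 0 →
                                + 4 ∣ + 2 * (x * x + y * y)
[1+2P]x+[1+2Q]y≡0⇒4∣2[x²+y²] P Q x y E≡0 = subst (+ 4 ∣_) (sym (identity P Q x y))
  (∣m∣n⇒∣m+n (∣m⇒∣m*n _ (subst (+ 4 ∣_) (sym E≡0) (divides (+ 0) refl)))
              (∣-multiple (+ 2 * ((P * x + Q * y) * (P * x + Q * y)) - x * y)))
  where
  identity : ∀ P Q x y →
    let E = (+ 1 + P * + 2) * x + (+ 1 + Q * + 2) * y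
        w = P * x + Q * y
    in + 2 * (x * x + y * y) ≡ E * (+ 2 * E - + 8 * w) + (+ 2 * (w * w) - x * y) * + 4
  identity = solve-∀

module Squares (a b : ℕ) where
  open QuatOps a b

  pureNorm : ℤ → ℤ → ℤ → ℤ
  pureNorm v1 v2 v3 = A * (v1 * v1) + B * (v2 * v2) + (A * B) * (v3 * v3)

  sqForm : Quat → Quat
  sqForm (quat x0 x1 x2 x3) =
    quat (x0 * x0 - pureNorm x1 x2 x3) (+ 2 * (x0 * x1)) (+ 2 * (x0 * x2)) (+ 2 * (x0 * x3))

  sq≡sqForm : ∀ x → sq x ≡ sqForm x
  sq≡sqForm (quat x0 x1 x2 x3) = quat-cong
    (real A B x0 x1 x2 x3) (pure B x0 x1 x2 x3) (pure A x0 x2 x3 x1) (pure-k x0 x1 x2 x3)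
    where
    real : ∀ A B x0 x1 x2 x3 → x0 * x0 - A * (x1 * x1) - B * (x2 * x2) - (A * B) * (x3 * x3)
                               ≡ x0 * x0 - (A * (x1 * x1) + B * (x2 * x2) + (A * B) * (x3 * x3))
    real = solve-∀
    pure : ∀ C x0 x y z → x0 * x + x * x0 + C * (y * z - z * y) ≡ + 2 * (x0 * x)
    pure = solve-∀
    pure-k : ∀ x0 x1 x2 x3 → x0 * x3 + x3 * x0 + x1 * x2 - x2 * x1 ≡ + 2 * (x0 * x3)
    pure-k = solve-∀

  sumSq≡sumSqForm : ∀ xs → sumSq xs ≡ foldr (λ x acc → sqForm x +Q acc) 0Q xs
  sumSq≡sumSqForm []       = refl
  sumSq≡sumSqForm (x ∷ xs) = cong₂ _+Q_ (sq≡sqForm x) (sumSq≡sumSqForm xs)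

  pureNorm-zero : pureNorm (+ 0) (+ 0) (+ 0) ≡ + 0
  pureNorm-zero = zero-identity A B
    where
    zero-identity : ∀ A B → A * (+ 0 * + 0) + B * (+ 0 * + 0) + (A * B) * (+ 0 * + 0) ≡ + 0
    zero-identity = solve-∀

  sq0Q : sq 0Q ≡ 0Q
  sq0Q = trans (sq≡sqForm 0Q) (quat-cong (cong (_-_ (+ 0)) pureNorm-zero) refl refl refl)

  1Q : Quat
  1Q = quat (+ 1) (+ 0) (+ 0) (+ 0)

  sq1Q : sq 1Q ≡ 1Q
  sq1Q = trans (sq≡sqForm 1Q) (quat-cong (cong (_-_ (+ 1)) pureNorm-zero) refl refl refl)

  twoK : Quat
  twoK = quat (+ 0) (+ 0) (+ 0) (+ 2)

  sqGroup-pureEven : ∀ {q} → InSqGroup q → + 2 ∣ c1 q × + 2 ∣ c2 q × + 2 ∣ c3 q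
  sqGroup-pureEven (gen x@(quat x0 x1 x2 x3)) =
    even (x0 * x1) (cong c1 eq) , even (x0 * x2) (cong c2 eq) , even (x0 * x3) (cong c3 eq)
    where
    eq = sq≡sqForm x
    even : ∀ {z} w → z ≡ + 2 * w → + 2 ∣ z
    even w e = subst (+ 2 ∣_) (sym e) (∣m⇒∣m*n w ∣-refl)
  sqGroup-pureEven zero = divides (+ 0) refl , divides (+ 0) refl , divides (+ 0) refl
  sqGroup-pureEven (neg q∈) with sqGroup-pureEven q∈
  ... | e1 , e2 , e3 = ∣m⇒∣-m e1 , ∣m⇒∣-m e2 , ∣m⇒∣-m e3
  sqGroup-pureEven (add p∈ q∈) with sqGroup-pureEven p∈ | sqGroup-pureEven q∈
  ... | d1 , d2 , d3 | e1 , e2 , e3 = ∣m∣n⇒∣m+n d1 e1 , ∣m∣n⇒∣m+n d2 e2 , ∣m∣n⇒∣m+n d3 e3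

  natural∈sqGroup : ∀ n → InSqGroup (quat (+ n) (+ 0) (+ 0) (+ 0))
  natural∈sqGroup zero    = zero
  natural∈sqGroup (suc n) =
    subst InSqGroup (cong (_+Q quat (+ n) (+ 0) (+ 0) (+ 0)) sq1Q) (add (gen 1Q) (natural∈sqGroup n))

  integer∈sqGroup : ∀ z → InSqGroup (quat z (+ 0) (+ 0) (+ 0))
  integer∈sqGroup (+ n)    = natural∈sqGroup n
  integer∈sqGroup -[1+ n ] = neg (natural∈sqGroup (suc n))

  twoK∈sqGroup : InSqGroup twoK
  twoK∈sqGroup = subst InSqGroup eq (add (gen 1+k) (integer∈sqGroup (A * B - + 1)))
    where
    1+k = quat (+ 1) (+ 0) (+ 0) (+ 1)
    abMinus1 = quat (A * B - + 1) (+ 0) (+ 0) (+ 0)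
    real : ∀ A B → + 1 * + 1 - (A * (+ 0 * + 0) + B * (+ 0 * + 0) + (A * B) * (+ 1 * + 1)) + (A * B - + 1) ≡ + 0
    real = solve-∀
    eq : sq 1+k +Q abMinus1 ≡ twoK
    eq = trans (cong (_+Q abMinus1) (sq≡sqForm 1+k)) (quat-cong (real A B) refl refl refl)

  sumOfTwoSquares≡twoK : ∀ p x1 x2 x3 q y1 y2 y3 →
    sumSq (quat p x1 x2 x3 ∷ quat q y1 y2 y3 ∷ []) ≡ twoK →
      p * p + q * q ≡ pureNorm x1 x2 x3 + pureNorm y1 y2 y3
    × p * x1 + q * y1 ≡ + 0 × p * x2 + q * y2 ≡ + 0 × p * x3 + q * y3 ≡ + 1
  sumOfTwoSquares≡twoK p x1 x2 x3 q y1 y2 y3 eq =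
      balance (p * p) (q * q) (pureNorm x1 x2 x3) (pureNorm y1 y2 y3) (cong c0 eq′)
    , halve (p * x1) (q * y1) (+ 0) (cong c1 eq′)
    , halve (p * x2) (q * y2) (+ 0) (cong c2 eq′)
    , halve (p * x3) (q * y3) (+ 1) (cong c3 eq′)
    where
    eq′ = trans (sym (sumSq≡sumSqForm (quat p x1 x2 x3 ∷ quat q y1 y2 y3 ∷ []))) eq
    rearrange : ∀ s t n m → s + t ≡ (s - n + (t - m + + 0)) + (n + m)
    rearrange = solve-∀
    balance : ∀ s t n m → s - n + (t - m + + 0) ≡ + 0 → s + t ≡ n + m
    balance s t n m e = trans (rearrange s t n m) (trans (cong (_+ (n + m)) e) (+-identityˡ (n + m)))
    factor : ∀ u v → + 2 * (u + v) ≡ + 2 * u + (+ 2 * v + + 0)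
    factor = solve-∀
    halve : ∀ u v w → + 2 * u + (+ 2 * v + + 0) ≡ + 2 * w → u + v ≡ w
    halve u v w e = *-cancelˡ-≡ (+ 2) (u + v) w (trans (factor u v) e)

  atMostTwo⇒sumOfTwo : ∀ xs → length xs ℕ.≤ 2 → ∃[ x ] ∃[ y ] sumSq xs ≡ sumSq (x ∷ y ∷ [])
  atMostTwo⇒sumOfTwo []              _ = 0Q , 0Q , sym (trans (cong (sq 0Q +Q_) sq0Q+0Q) sq0Q+0Q)
    where sq0Q+0Q = cong (_+Q 0Q) sq0Q
  atMostTwo⇒sumOfTwo (x ∷ [])        _ = x , 0Q , cong (sq x +Q_) (sym (cong (_+Q 0Q) sq0Q))
  atMostTwo⇒sumOfTwo (x ∷ y ∷ [])    _ = x , y , refl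
  atMostTwo⇒sumOfTwo (_ ∷ _ ∷ _ ∷ _) (s≤s (s≤s ()))

  NotSumOfTwoSquares : Quat → Set
  NotSumOfTwoSquares q = ∀ x y → sumSq (x ∷ y ∷ []) ≢ q

  isG2-3 : SumOfAtMost 3 → NotSumOfTwoSquares twoK → IsG2 a b 3
  isG2-3 three notTwo = s≤s z≤n , three , minimal
    where
    minimal : ∀ h → 0 ℕ.< h → SumOfAtMost h → 3 ℕ.≤ h
    minimal h _ H with 3 ℕ.≤? h
    ... | yes 3≤h = 3≤h
    ... | no 3≰h with H twoK twoK∈sqGroup
    ... | xs , |xs|≤h , eq with atMostTwo⇒sumOfTwo xs (ℕ.≤-trans |xs|≤h (ℕ.≤-pred (ℕ.≰⇒> 3≰h)))
    ... | x , y , eq′ = ⊥-elim (notTwo x y (trans (sym eq′) eq))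

module SumsOfThreeSquares (b : ℕ) where
  open QuatOps 2 b
  open Squares 2 b

  oddWitness : ℤ → ℤ → ℤ → ℤ → List Quat
  oddWitness k v1 v2 v3 = quat (r + + 1) v1 v2 v3 ∷ quat r (- v1) (- v2) (- v3) ∷ quat (+ 0) r (+ 0) (+ 0) ∷ []
    where r = k + pureNorm v1 v2 v3

  evenWitness : ℤ → ℤ → ℤ → ℤ → List Quat
  evenWitness k v1 v2 v3 =
    quat (r + + 1) v1 v2 v3 ∷ quat r (- (v1 + + 1)) (- v2) (- v3) ∷ quat (+ 1) r (+ 0) (+ 0) ∷ []
    where r = k + pureNorm v1 v2 v3 + + 2 * v1

  private
    cancel : ∀ r v → + 2 * ((r + + 1) * v) + (+ 2 * (r * (- v)) + + 0) ≡ v * + 2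
    cancel = solve-∀

  -- N below is pureNorm spelled out, since the ring solver does not unfold definitions.
  oddWitness-sumSq : ∀ k v1 v2 v3 →
    sumSq (oddWitness k v1 v2 v3) ≡ quat (+ 1 + k * + 2) (v1 * + 2) (v2 * + 2) (v3 * + 2)
  oddWitness-sumSq k v1 v2 v3 = trans (sumSq≡sumSqForm (oddWitness k v1 v2 v3))
    (quat-cong (real B k v1 v2 v3) (cancel r v1) (cancel r v2) (cancel r v3))
    where
    r = k + pureNorm v1 v2 v3
    real : ∀ B k v1 v2 v3 →
      let N = λ x y z → + 2 * (x * x) + B * (y * y) + (+ 2 * B) * (z * z)
          r = k + N v1 v2 v3
      in (r + + 1) * (r + + 1) - N v1 v2 v3
         + ((r * r - N (- v1) (- v2) (- v3)) + ((+ 0 * + 0 - N r (+ 0) (+ 0)) + + 0))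
         ≡ + 1 + k * + 2
    real = solve-∀

  evenWitness-sumSq : ∀ k v1 v2 v3 →
    sumSq (evenWitness k v1 v2 v3) ≡ quat (+ 0 + k * + 2) (v1 * + 2) (v2 * + 2) (v3 * + 2)
  evenWitness-sumSq k v1 v2 v3 = trans (sumSq≡sumSqForm (evenWitness k v1 v2 v3))
    (quat-cong (real B k v1 v2 v3) (cancel-i r v1) (cancel r v2) (cancel r v3))
    where
    r = k + pureNorm v1 v2 v3 + + 2 * v1
    real : ∀ B k v1 v2 v3 →
      let N = λ x y z → + 2 * (x * x) + B * (y * y) + (+ 2 * B) * (z * z)
          r = k + N v1 v2 v3 + + 2 * v1
      in (r + + 1) * (r + + 1) - N v1 v2 v3
         + ((r * r - N (- (v1 + + 1)) (- v2) (- v3)) + ((+ 1 * + 1 - N r (+ 0) (+ 0)) + + 0))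
         ≡ + 0 + k * + 2
    real = solve-∀
    cancel-i : ∀ r v → + 2 * ((r + + 1) * v) + (+ 2 * (r * (- (v + + 1))) + (+ 2 * (+ 1 * r) + + 0)) ≡ v * + 2
    cancel-i = solve-∀

  sumOfThreeSquares : SumOfAtMost 3
  sumOfThreeSquares q q∈ with sqGroup-pureEven q∈ | residue 2 (c0 q)
  ... | divides v1 e1 , divides v2 e2 , divides v3 e3 | 0 , k , _ , e0 =
    evenWitness k v1 v2 v3 , ℕ.≤-refl , trans (evenWitness-sumSq k v1 v2 v3) (sym (quat-cong e0 e1 e2 e3))
  ... | divides v1 e1 , divides v2 e2 , divides v3 e3 | 1 , k , _ , e0 =
    oddWitness k v1 v2 v3 , ℕ.≤-refl , trans (oddWitness-sumSq k v1 v2 v3) (sym (quat-cong e0 e1 e2 e3))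
  ... | _ | suc (suc _) , _ , s≤s (s≤s ()) , _

module NoTwoSquares₂₂ where
  open QuatOps 2 2
  open Squares 2 2

  2∣norms : ∀ x1 x2 x3 y1 y2 y3 → + 2 ∣ pureNorm x1 x2 x3 + pureNorm y1 y2 y3
  2∣norms x1 x2 x3 y1 y2 y3 =
    divides (x1 * x1 + x2 * x2 + + 2 * (x3 * x3) + y1 * y1 + y2 * y2 + + 2 * (y3 * y3)) (factor x1 x2 x3 y1 y2 y3)
    where
    factor : ∀ x1 x2 x3 y1 y2 y3 →
      + 2 * (x1 * x1) + + 2 * (x2 * x2) + (+ 2 * + 2) * (x3 * x3)
        + (+ 2 * (y1 * y1) + + 2 * (y2 * y2) + (+ 2 * + 2) * (y3 * y3))
      ≡ (x1 * x1 + x2 * x2 + + 2 * (x3 * x3) + y1 * y1 + y2 * y2 + + 2 * (y3 * y3)) * + 2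
    factor = solve-∀

  4∣norms : ∀ P Q x1 x2 x3 y1 y2 y3 →
    (+ 1 + P * + 2) * x1 + (+ 1 + Q * + 2) * y1 ≡ + 0 → (+ 1 + P * + 2) * x2 + (+ 1 + Q * + 2) * y2 ≡ + 0 →
    + 4 ∣ pureNorm x1 x2 x3 + pureNorm y1 y2 y3
  4∣norms P Q x1 x2 x3 y1 y2 y3 e1 e2 = subst (+ 4 ∣_) (sym (regroup x1 x2 x3 y1 y2 y3))
    (∣m∣n⇒∣m+n (∣m∣n⇒∣m+n ([1+2P]x+[1+2Q]y≡0⇒4∣2[x²+y²] P Q x1 y1 e1)
                            ([1+2P]x+[1+2Q]y≡0⇒4∣2[x²+y²] P Q x2 y2 e2))
                (∣-multiple (x3 * x3 + y3 * y3)))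
    where
    regroup : ∀ x1 x2 x3 y1 y2 y3 →
      + 2 * (x1 * x1) + + 2 * (x2 * x2) + (+ 2 * + 2) * (x3 * x3)
        + (+ 2 * (y1 * y1) + + 2 * (y2 * y2) + (+ 2 * + 2) * (y3 * y3))
      ≡ + 2 * (x1 * x1 + y1 * y1) + + 2 * (x2 * x2 + y2 * y2) + (x3 * x3 + y3 * y3) * + 4
    regroup = solve-∀

  twoSquareEquations-unsolvable : ∀ p q x1 x2 x3 y1 y2 y3 →
    p * p + q * q ≡ pureNorm x1 x2 x3 + pureNorm y1 y2 y3 →
    p * x1 + q * y1 ≡ + 0 → p * x2 + q * y2 ≡ + 0 → p * x3 + q * y3 ≡ + 1 → ⊥
  twoSquareEquations-unsolvable p q x1 x2 x3 y1 y2 y3 norms e1 e2 e3 with residue 2 p | residue 2 q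
  ... | 0 , P , _ , refl | 0 , Q , _ , refl =
    ∤-by-decision tt (subst (+ 2 ∣_) e3 (∣p∣q⇒∣px+qy x3 y3 (∣0+k*d P) (∣0+k*d Q)))
  ... | 1 , P , _ , refl | 0 , Q , _ , refl =
    ∤-by-decision tt (∣4⇒∣[r+2P]²+[s+2Q]²⇒∣r²+s² (+ 1) P (+ 0) Q (divides (+ 2) refl)
      (subst (+ 2 ∣_) (sym norms) (2∣norms x1 x2 x3 y1 y2 y3)))
  ... | 0 , P , _ , refl | 1 , Q , _ , refl =
    ∤-by-decision tt (∣4⇒∣[r+2P]²+[s+2Q]²⇒∣r²+s² (+ 0) P (+ 1) Q (divides (+ 2) refl)
      (subst (+ 2 ∣_) (sym norms) (2∣norms x1 x2 x3 y1 y2 y3)))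
  ... | 1 , P , _ , refl | 1 , Q , _ , refl =
    ∤-by-decision tt (∣4⇒∣[r+2P]²+[s+2Q]²⇒∣r²+s² (+ 1) P (+ 1) Q ∣-refl
      (subst (+ 4 ∣_) (sym norms) (4∣norms P Q x1 x2 x3 y1 y2 y3 e1 e2)))
  ... | suc (suc _) , _ , s≤s (s≤s ()) , _ | _
  ... | _ | suc (suc _) , _ , s≤s (s≤s ()) , _

  notSumOfTwoSquares : NotSumOfTwoSquares twoK
  notSumOfTwoSquares (quat p x1 x2 x3) (quat q y1 y2 y3) eq =
    let norms , e1 , e2 , e3 = sumOfTwoSquares≡twoK p x1 x2 x3 q y1 y2 y3 eq
    in twoSquareEquations-unsolvable p q x1 x2 x3 y1 y2 y3 norms e1 e2 e3

module NoTwoSquares₂₃ where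
  open QuatOps 2 3
  open Squares 2 3

  twoSquareEquations-unsolvable : ∀ p q x1 x2 x3 y1 y2 y3 →
    p * p + q * q ≡ pureNorm x1 x2 x3 + pureNorm y1 y2 y3 →
    p * x1 + q * y1 ≡ + 0 → p * x3 + q * y3 ≡ + 1 → ⊥
  twoSquareEquations-unsolvable p q x1 x2 x3 y1 y2 y3 norms e1 e3 =
    ∤-by-decision tt (subst (+ 3 ∣_) e3 (∣p∣q⇒∣px+qy x3 y3 3∣p 3∣q))
    where
    mod3 : ∀ x1 x2 x3 y1 y2 y3 →
      + 2 * (x1 * x1) + + 3 * (x2 * x2) + (+ 2 * + 3) * (x3 * x3)
        + (+ 2 * (y1 * y1) + + 3 * (y2 * y2) + (+ 2 * + 3) * (y3 * y3)) + (x1 * x1 + y1 * y1)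
      ≡ (x1 * x1 + y1 * y1 + x2 * x2 + y2 * y2 + + 2 * (x3 * x3) + + 2 * (y3 * y3)) * + 3
    mod3 = solve-∀
    plus : ∀ p q x y → (p + x) * (p + x) + (q + y) * (q + y) ≡ p * p + q * q + (x * x + y * y) + + 2 * (p * x + q * y)
    plus = solve-∀
    minus : ∀ p q x y → (p - x) * (p - x) + (q - y) * (q - y) ≡ p * p + q * q + (x * x + y * y) - + 2 * (p * x + q * y)
    minus = solve-∀
    3∣S : + 3 ∣ p * p + q * q + (x1 * x1 + y1 * y1)
    3∣S = divides (x1 * x1 + y1 * y1 + x2 * x2 + y2 * y2 + + 2 * (x3 * x3) + + 2 * (y3 * y3))
      (trans (cong (_+ (x1 * x1 + y1 * y1)) norms) (mod3 x1 x2 x3 y1 y2 y3))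
    3∣2e1 : + 3 ∣ + 2 * (p * x1 + q * y1)
    3∣2e1 = subst (λ t → + 3 ∣ + 2 * t) (sym e1) (divides (+ 0) refl)
    3∣plus : + 3 ∣ (p + x1) * (p + x1) + (q + y1) * (q + y1)
    3∣plus = subst (+ 3 ∣_) (sym (plus p q x1 y1)) (∣m∣n⇒∣m+n 3∣S 3∣2e1)
    3∣minus : + 3 ∣ (p - x1) * (p - x1) + (q - y1) * (q - y1)
    3∣minus = subst (+ 3 ∣_) (sym (minus p q x1 y1)) (∣m∣n⇒∣m-n 3∣S 3∣2e1)
    3∣p : + 3 ∣ p
    3∣p = 3∣m+n⇒3∣m-n⇒3∣m p x1
      (3∣m²+n²⇒3∣m (p + x1) (q + y1) 3∣plus) (3∣m²+n²⇒3∣m (p - x1) (q - y1) 3∣minus)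
    3∣q : + 3 ∣ q
    3∣q = 3∣m+n⇒3∣m-n⇒3∣m q y1
      (3∣m²+n²⇒3∣n (p + x1) (q + y1) 3∣plus) (3∣m²+n²⇒3∣n (p - x1) (q - y1) 3∣minus)

  notSumOfTwoSquares : NotSumOfTwoSquares twoK
  notSumOfTwoSquares (quat p x1 x2 x3) (quat q y1 y2 y3) eq =
    let norms , e1 , _ , e3 = sumOfTwoSquares≡twoK p x1 x2 x3 q y1 y2 y3 eq
    in twoSquareEquations-unsolvable p q x1 x2 x3 y1 y2 y3 norms e1 e3

mainTheorem9 : IsG2 2 2 3 × IsG2 2 3 3
mainTheorem9 =
    Squares.isG2-3 2 2 (SumsOfThreeSquares.sumOfThreeSquares 2) NoTwoSquares₂₂.notSumOfTwoSquares
  , Squares.isG2-3 2 3 (SumsOfThreeSquares.sumOfThreeSquares 3) NoTwoSquares₂₃.notSumOfTwoSquares
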